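{- Let $X=(S,\mathcal{L})$ be a pairwise balanced design. (i) A permutation $f:S\to S$ is a morphism if and only if $f$ is an automorphism of $X$. (ii) A partial constant map $f:S\to S$ is a morphism if and only if $f$ is the empty function or the domain of $f$ is a non-empty open subset of $S$ and its image is a single point.
   Context: A PBD is a pair $(S,\mathcal{L})$ with $S$ finite and $\mathcal{L}$ a set of subsets (blocks) of size at least 2 such that every pair of distinct points lies in exactly one block (degenerate cases with fewer than two blocks excluded). A subsystem is a set $F\subseteq S$ such that for all distinct $x,y\in F$ the block containing them is contained in $F$; an open set is the complement of a subsystem. For a partial function $f:S\to S$ put $f^{ -w}(B)=f^{ -1}(B)\cup(S\setminus Dom(f))$; $f$ is a morphism if $f^{ -w}(F)$ is a subsystem for every subsystem $F$. An automorphism is a permutation of $S$ mapping blocks to blocks. A partial constant map is a partial function $f$ with $|f(S)|\le1$. -}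

module Defs where

open import Data.Nat using (ℕ; _≤_)
open import Data.Fin using (Fin)
open import Data.Fin.Subset using (Subset; _∈_; _⊆_; ∣_∣; ∁)
open import Data.Maybe using (Maybe; just; nothing; maybe′; is-just)
open import Data.Vec using (tabulate; lookup)
open import Data.Bool using (true)
open import Data.Product using (Σ; ∃; ∃-syntax; ∃!; _×_)
open import Data.Sum using (_⊎_)
open import Function.Bundles using (_⇔_)
open import Data.Fin.Permutation using (Permutation′; _⟨$⟩ʳ_)
open import Relation.Binary.PropositionalEquality using (_≡_; _≢_)

record PBD (n : ℕ) : Set where
  field
    m          : ℕ
    block      : Fin m → Subset n
    blockSize  : ∀ b → 2 ≤ ∣ block b ∣
    pairUnique : ∀ (x y : Fin n) → x ≢ y →
                 ∃! _≡_ (λ b → x ∈ block b × y ∈ block b)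
    -- degenerate cases (fewer than two blocks) excluded
    twoBlocks  : 2 ≤ m

module _ {n : ℕ} (X : PBD n) where
  open PBD X

  IsSubsystem : Subset n → Set
  IsSubsystem F = ∀ (x y : Fin n) → x ≢ y → x ∈ F → y ∈ F →
                  ∀ b → x ∈ block b → y ∈ block b → block b ⊆ F

  IsOpen : Subset n → Set
  IsOpen U = Σ (Subset n) (λ F → IsSubsystem F × U ≡ ∁ F)

  -- partial functions S ⇀ S are modelled as Fin n → Maybe (Fin n)
  -- weak preimage f^{-w}(B) = f^{-1}(B) ∪ (S ∖ Dom f)
  wpre : (Fin n → Maybe (Fin n)) → Subset n → Subset n
  wpre f B = tabulate (λ x → maybe′ (λ y → lookup B y) true (f x))

  IsMorphism : (Fin n → Maybe (Fin n)) → Set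
  IsMorphism f = ∀ F → IsSubsystem F → IsSubsystem (wpre f F)

  IsAutomorphism : Permutation′ n → Set
  IsAutomorphism π = ∀ b → ∃[ b′ ] (∀ y → (y ∈ block b′) ⇔ (∃[ x ] (x ∈ block b × π ⟨$⟩ʳ x ≡ y)))

asPartial : ∀ {n} → Permutation′ n → Fin n → Maybe (Fin n)
asPartial π x = just (π ⟨$⟩ʳ x)

Dom : ∀ {n} → (Fin n → Maybe (Fin n)) → Subset n
Dom f = tabulate (λ x → is-just (f x))

IsPartialConstant : ∀ {n} → (Fin n → Maybe (Fin n)) → Set
IsPartialConstant {n} f = ∀ (x y : Fin n) a b → f x ≡ just a → f y ≡ just b → a ≡ b

IsEmptyFunction : ∀ {n} → (Fin n → Maybe (Fin n)) → Set
IsEmptyFunction {n} f = ∀ (x : Fin n) → f x ≡ nothing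

ImageIsPoint : ∀ {n} → (Fin n → Maybe (Fin n)) → Set
ImageIsPoint {n} f = ∃[ p ] (∀ (y : Fin n) → (∃[ x ] (f x ≡ just y)) ⇔ (y ≡ p))

module Submission where

-- (i) If π maps blocks onto blocks, the preimage of a subsystem is again a
-- subsystem, since a block through two points of the preimage is sent into
-- the block through their images.  Conversely, if π is a morphism, preimages
-- of blocks are subsystems, so π maps each block b into the block c through
-- the images of two of its points.  For the reverse inclusion we need that
-- preimages under π⁻¹ are subsystems too: on a finite set π⁻¹ is an iterate
-- of π (every injective endofunction of Fin n has a common period), and
-- iterates of a morphism are morphisms.
-- (ii) For a partial map with values only in {p}, the weak preimage of F is
-- all of S when p ∈ F and the complement of the domain when p ∉ F.  So a
-- non-empty partial constant morphism has open domain (take F = ∅), and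
-- conversely an open domain makes every weak preimage a subsystem.

open import Defs
open import Data.Nat using (ℕ; zero; suc; _+_; _*_; _≤_; s≤s; z≤n)
open import Data.Nat.Properties using (≤-trans; ≤-reflexive; +-suc; *-comm; n<1+n; m≤n⇒∃[o]m+o≡n)
open import Data.Fin as Fin using (Fin; toℕ)
open import Data.Fin.Properties using (pigeonhole; any?; _≟_)
open import Data.Fin.Subset using (Subset; _∈_; _∉_; _⊆_; ∣_∣; ∁; ⊤; ⊥; ⁅_⁆)
open import Data.Fin.Subset.Properties
  using (_∈?_; nonempty?; ∈⊤; ∉⊥; x∈⁅x⁆; ∣⊥∣≡0; ∣⁅x⁆∣≡1; p⊆q⇒∣p∣≤∣q∣;
         ⊆-antisym; x∈∁p⇒x∉p; x∉p⇒x∈∁p; x∈p⇒x∉∁p; x∉∁p⇒x∈p)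
open import Data.Fin.Permutation using (Permutation′; _⟨$⟩ʳ_)
open import Data.Maybe using (Maybe; just; nothing; maybe′; is-just)
open import Data.Bool using (true)
open import Data.Vec using (lookup)
open import Data.Vec.Properties using (lookup∘tabulate; []=⇒lookup; lookup⇒[]=)
open import Data.Product using (_×_; _,_; proj₁; proj₂; ∃₂; ∃-syntax)
open import Data.Sum using (_⊎_; inj₁; inj₂)
open import Function.Base using (_∘_)
open import Function.Bundles using (_⇔_; mk⇔; Equivalence; Injection)
open import Function.Definitions using (Injective)
open import Function.Properties.Inverse using (↔⇒↣)
open import Relation.Nullary using (¬_; Dec; yes; no; ¬?; contradiction)
open import Relation.Nullary.Decidable using (_×-dec_)
open import Relation.Binary.PropositionalEquality
open ≡-Reasoning
open Equivalence using (to; from)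

private
  variable
    n : ℕ

iterate : {A : Set} → (A → A) → ℕ → A → A
iterate g zero    x = x
iterate g (suc k) x = g (iterate g k x)

module _ {A : Set} (g : A → A) where

  iterate-+ : ∀ j k x → iterate g (j + k) x ≡ iterate g j (iterate g k x)
  iterate-+ zero    k x = refl
  iterate-+ (suc j) k x = cong g (iterate-+ j k x)

  iterate-comm : ∀ k x → iterate g k (g x) ≡ g (iterate g k x)
  iterate-comm zero    x = refl
  iterate-comm (suc k) x = cong g (iterate-comm k x)

  iterate-* : ∀ {p x} → iterate g p x ≡ x → ∀ m → iterate g (m * p) x ≡ x
  iterate-* fix zero    = refl
  iterate-* {p} {x} fix (suc m) = begin
    iterate g (p + m * p) x           ≡⟨ iterate-+ p (m * p) x ⟩
    iterate g p (iterate g (m * p) x) ≡⟨ cong (iterate g p) (iterate-* fix m) ⟩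
    iterate g p x                     ≡⟨ fix ⟩
    x                                 ∎

  iterate-injective : Injective _≡_ _≡_ g → ∀ k → Injective _≡_ _≡_ (iterate g k)
  iterate-injective inj zero    eq = eq
  iterate-injective inj (suc k) eq = iterate-injective inj k (inj eq)

-- For an injective endofunction of a finite set every point is periodic:
-- two of x, g x, …, g^n x coincide by pigeonhole, and g^a cancels.
pointPeriod : (g : Fin n → Fin n) → Injective _≡_ _≡_ g →
              ∀ x → ∃[ k ] (iterate g (suc k) x ≡ x)
pointPeriod {n} g inj x
  with i , j , i<j , gⁱx≡gʲx ← pigeonhole (n<1+n n) (λ i → iterate g (toℕ i) x)
  with k , a+k≡b ← m≤n⇒∃[o]m+o≡n i<j
  = k , iterate-injective g inj a (begin
      iterate g a (iterate g (suc k) x) ≡⟨ iterate-+ g a (suc k) x ⟨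
      iterate g (a + suc k) x           ≡⟨ cong (λ t → iterate g t x) (trans (+-suc a k) a+k≡b) ⟩
      iterate g (toℕ j) x               ≡⟨ gⁱx≡gʲx ⟨
      iterate g a x                     ∎)
  where
  a : ℕ
  a = toℕ i

-- Finitely many periodic points have a common period (the product of theirs).
commonPeriod : (g : Fin n → Fin n) → Injective _≡_ _≡_ g →
               ∀ m (pts : Fin m → Fin n) → ∃[ K ] (∀ i → iterate g (suc K) (pts i) ≡ pts i)
commonPeriod g inj zero    pts = 0 , λ ()
commonPeriod g inj (suc m) pts
  with q , periodic₀ ← pointPeriod g inj (pts Fin.zero)
     | P , periodic  ← commonPeriod g inj m (pts ∘ Fin.suc)
  = P + q * suc P , common
  where
  -- suc (P + q * suc P) is definitionally suc q * suc P
  common : ∀ i → iterate g (suc q * suc P) (pts i) ≡ pts i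
  common Fin.zero    = subst (λ t → iterate g t (pts Fin.zero) ≡ pts Fin.zero)
                             (*-comm (suc P) (suc q)) (iterate-* g {suc q} periodic₀ (suc P))
  common (Fin.suc i) = iterate-* g {suc P} (periodic i) (suc q)

period : (g : Fin n → Fin n) → Injective _≡_ _≡_ g →
         ∃[ K ] (∀ x → iterate g (suc K) x ≡ x)
period {n} g inj = commonPeriod g inj n (λ x → x)

notInsideSmall : {p q : Subset n} → 2 ≤ ∣ p ∣ → p ⊆ q → ¬ (∣ q ∣ ≤ 1)
notInsideSmall 2≤∣p∣ p⊆q ∣q∣≤1 with ≤-trans 2≤∣p∣ (≤-trans (p⊆q⇒∣p∣≤∣q∣ p⊆q) ∣q∣≤1)
... | s≤s ()

twoElements : (p : Subset n) → 2 ≤ ∣ p ∣ → ∃₂ λ x y → x ≢ y × x ∈ p × y ∈ p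
twoElements {n} p 2≤∣p∣ with nonempty? p
... | no noElement = contradiction (≤-trans (≤-reflexive (∣⊥∣≡0 n)) z≤n)
                       (notInsideSmall {q = ⊥} 2≤∣p∣ λ x∈p → contradiction (_ , x∈p) noElement)
... | yes (x , x∈p) with any? (λ y → (y ∈? p) ×-dec ¬? (x ≟ y))
...   | yes (y , y∈p , x≢y) = x , y , x≢y , x∈p , y∈p
...   | no noOther = contradiction (≤-reflexive (∣⁅x⁆∣≡1 x)) (notInsideSmall 2≤∣p∣ p⊆⁅x⁆)
  where
  p⊆⁅x⁆ : p ⊆ ⁅ x ⁆
  p⊆⁅x⁆ {y} y∈p with x ≟ y
  ... | yes refl = x∈⁅x⁆ x
  ... | no x≢y   = contradiction (y , y∈p , x≢y) noOther

emptyOrValue : {A : Set} (f : Fin n → Maybe A) →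
               (∀ x → f x ≡ nothing) ⊎ ∃₂ (λ x p → f x ≡ just p)
emptyOrValue {zero}  f = inj₁ λ ()
emptyOrValue {suc n} f with f Fin.zero in f₀≡
... | just p  = inj₂ (Fin.zero , p , f₀≡)
... | nothing with emptyOrValue (f ∘ Fin.suc)
...   | inj₁ none           = inj₁ λ { Fin.zero → f₀≡ ; (Fin.suc x) → none x }
...   | inj₂ (x , p , fx≡p) = inj₂ (Fin.suc x , p , fx≡p)

∁-∁ : (p : Subset n) → ∁ (∁ p) ≡ p
∁-∁ p = ⊆-antisym (x∉∁p⇒x∈p ∘ x∈∁p⇒x∉p) (x∉p⇒x∈∁p ∘ x∈p⇒x∉∁p)

module _ {f : Fin n → Maybe (Fin n)} where

  value⇒∈Dom : ∀ {x y} → f x ≡ just y → x ∈ Dom f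
  value⇒∈Dom {x} fx≡y = lookup⇒[]= x (Dom f) (trans (lookup∘tabulate _ x) (cong is-just fx≡y))

  ∈∁Dom⇔ : ∀ {x} → x ∈ ∁ (Dom f) ⇔ f x ≡ nothing
  ∈∁Dom⇔ {x} = mk⇔ undefined (x∉p⇒x∈∁p ∘ notInDom)
    where
    undefined : x ∈ ∁ (Dom f) → f x ≡ nothing
    undefined x∈∁Dom with f x in fx≡
    ... | nothing = refl
    ... | just y  = contradiction (value⇒∈Dom fx≡) (x∈∁p⇒x∉p x∈∁Dom)
    notInDom : f x ≡ nothing → x ∉ Dom f
    notInDom fx≡nothing x∈Dom with () ← subst (λ m → is-just m ≡ true) fx≡nothing
                                          (trans (sym (lookup∘tabulate _ x)) ([]=⇒lookup x∈Dom))

module _ (X : PBD n) where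
  open PBD X

  ∈-wpre : ∀ f {F x} → x ∈ wpre X f F ⇔ (∀ {y} → f x ≡ just y → y ∈ F)
  ∈-wpre f {F} {x} = mk⇔ valuesIn fromValues
    where
    lookup-wpre : lookup (wpre X f F) x ≡ maybe′ (lookup F) true (f x)
    lookup-wpre = lookup∘tabulate _ x
    valuesIn : x ∈ wpre X f F → ∀ {y} → f x ≡ just y → y ∈ F
    valuesIn x∈ {y} fx≡y = lookup⇒[]= y F (begin
      maybe′ (lookup F) true (just y) ≡⟨ cong (maybe′ (lookup F) true) fx≡y ⟨
      maybe′ (lookup F) true (f x)    ≡⟨ lookup-wpre ⟨
      lookup (wpre X f F) x           ≡⟨ []=⇒lookup x∈ ⟩
      true                            ∎)
    fromValues : (∀ {y} → f x ≡ just y → y ∈ F) → x ∈ wpre X f F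
    fromValues valuesIn = lookup⇒[]= x _ (trans lookup-wpre (maybeTrue (f x) refl))
      where
      maybeTrue : ∀ m → f x ≡ m → maybe′ (lookup F) true m ≡ true
      maybeTrue nothing  _     = refl
      maybeTrue (just y) fx≡y = []=⇒lookup (valuesIn fx≡y)

  ∈-preimage : ∀ (g : Fin n → Fin n) {F x} → x ∈ wpre X (just ∘ g) F ⇔ g x ∈ F
  ∈-preimage g = mk⇔ (λ x∈ → to (∈-wpre (just ∘ g)) x∈ refl)
                     (λ gx∈F → from (∈-wpre (just ∘ g)) λ { refl → gx∈F })

  wpre-covering : ∀ f F → (∀ {x y} → f x ≡ just y → y ∈ F) → wpre X f F ≡ ⊤
  wpre-covering f F valuesIn = ⊆-antisym (λ _ → ∈⊤) (λ _ → from (∈-wpre f) valuesIn)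

  wpre-avoiding : ∀ f F → (∀ {x y} → f x ≡ just y → y ∉ F) → wpre X f F ≡ ∁ (Dom f)
  wpre-avoiding f F valuesOut = ⊆-antisym (from ∈∁Dom⇔ ∘ undefined) definedNowhere
    where
    undefined : ∀ {x} → x ∈ wpre X f F → f x ≡ nothing
    undefined {x} x∈ with f x in fx≡
    ... | nothing = refl
    ... | just y  = contradiction (to (∈-wpre f) x∈ fx≡) (valuesOut fx≡)
    definedNowhere : ∁ (Dom f) ⊆ wpre X f F
    definedNowhere x∈∁Dom = from (∈-wpre f {F}) λ fx≡y →
      contradiction (trans (sym (to ∈∁Dom⇔ x∈∁Dom)) fx≡y) λ ()

  ⊤-subsystem : IsSubsystem X ⊤
  ⊤-subsystem _ _ _ _ _ _ _ _ _ = ∈⊤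

  ⊥-subsystem : IsSubsystem X ⊥
  ⊥-subsystem _ _ _ x∈⊥ = contradiction x∈⊥ ∉⊥

  -- every block is a subsystem: a block through two of its points is itself
  block-subsystem : ∀ c → IsSubsystem X (block c)
  block-subsystem c x y x≢y x∈c y∈c b x∈b y∈b z∈b
    with _ , _ , unique ← pairUnique x y x≢y
    = subst (λ k → _ ∈ block k) (trans (sym (unique (x∈b , y∈b))) (unique (x∈c , y∈c))) z∈b

  preimage-id : ∀ F → wpre X just F ≡ F
  preimage-id F = ⊆-antisym (to (∈-preimage (λ x → x))) (from (∈-preimage (λ x → x)))

  preimage-∘ : ∀ (g h : Fin n → Fin n) F →
               wpre X (just ∘ g ∘ h) F ≡ wpre X (just ∘ h) (wpre X (just ∘ g) F)
  preimage-∘ g h F =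
    ⊆-antisym (from (∈-preimage h) ∘ from (∈-preimage g) ∘ to (∈-preimage (g ∘ h) {F}))
              (from (∈-preimage (g ∘ h)) ∘ to (∈-preimage g {F}) ∘ to (∈-preimage h))

  morphism-iterate : ∀ (g : Fin n → Fin n) → IsMorphism X (just ∘ g) →
                     ∀ k → IsMorphism X (just ∘ iterate g k)
  morphism-iterate g mor zero F F-sub = subst (IsSubsystem X) (sym (preimage-id F)) F-sub
  morphism-iterate g mor (suc k) F F-sub =
    subst (IsSubsystem X) (sym (preimage-∘ g (iterate g k) F))
          (morphism-iterate g mor k _ (mor F F-sub))

  module _ (π : Permutation′ n) where

    σ : Fin n → Fin n
    σ = π ⟨$⟩ʳ_

    σ-injective : Injective _≡_ _≡_ σ
    σ-injective = Injection.injective (↔⇒↣ π)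

    -- (i, ⇐) a block through two points of σ⁻¹(F) is sent into the block
    -- through their images, which F contains
    automorphism⇒morphism : IsAutomorphism X π → IsMorphism X (asPartial π)
    automorphism⇒morphism auto F F-sub x y x≢y x∈ y∈ b x∈b y∈b z∈b =
      from (∈-preimage σ)
        (F-sub _ _ (x≢y ∘ σ-injective) (to (∈-preimage σ) x∈) (to (∈-preimage σ) y∈)
               (proj₁ (auto b)) (image x∈b) (image y∈b) (image z∈b))
      where
      image : ∀ {w} → w ∈ block b → σ w ∈ block (proj₁ (auto b))
      image w∈b = from (proj₂ (auto b) _) (_ , w∈b , refl)

    -- (i, ⇒) σ maps a block b onto the block c through the images of two of
    -- its points
    morphism⇒automorphism : IsMorphism X (asPartial π) → IsAutomorphism X π
    morphism⇒automorphism mor b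
      with x , y , x≢y , x∈b , y∈b ← twoElements (block b) (blockSize b)
      with c , (σx∈c , σy∈c) , _ ← pairUnique (σ x) (σ y) (x≢y ∘ σ-injective)
      = c , λ z → mk⇔ (preimageIn z) imageIn
      where
      -- σ⁻¹(c) is a subsystem through x and y, hence contains b
      imageIn : ∀ {z} → ∃[ w ] (w ∈ block b × σ w ≡ z) → z ∈ block c
      imageIn (w , w∈b , refl) =
        to (∈-preimage σ) (mor (block c) (block-subsystem c) x y x≢y
                               (from (∈-preimage σ) σx∈c) (from (∈-preimage σ) σy∈c) b x∈b y∈b w∈b)
      -- σ⁻¹ = σ^K, and the σ^K-preimage of b is a subsystem through σ x and
      -- σ y, hence contains c
      preimageIn : ∀ z → z ∈ block c → ∃[ w ] (w ∈ block b × σ w ≡ z)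
      preimageIn z z∈c = iterate σ K z , iterateInB , periodic z
        where
        K : ℕ
        K = proj₁ (period σ σ-injective)
        periodic : ∀ w → iterate σ (suc K) w ≡ w
        periodic = proj₂ (period σ σ-injective)
        returns : ∀ {w} → w ∈ block b → σ w ∈ wpre X (just ∘ iterate σ K) (block b)
        returns {w} w∈b = from (∈-preimage (iterate σ K))
          (subst (_∈ block b) (sym (trans (iterate-comm σ K w) (periodic w))) w∈b)
        iterateInB : iterate σ K z ∈ block b
        iterateInB = to (∈-preimage (iterate σ K))
          (morphism-iterate σ mor K (block b) (block-subsystem b) _ _ (x≢y ∘ σ-injective)
                            (returns x∈b) (returns y∈b) c σx∈c σy∈c z∈c)

  EmptyOrPointOnOpen : (Fin n → Maybe (Fin n)) → Set
  EmptyOrPointOnOpen f =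
    IsEmptyFunction f ⊎ ((∃[ x ] (x ∈ Dom f)) × IsOpen X (Dom f) × ImageIsPoint f)

  imageIsPoint : ∀ {f : Fin n → Maybe (Fin n)} → IsPartialConstant f →
                 ∀ {x₀ p} → f x₀ ≡ just p → ImageIsPoint f
  imageIsPoint pc {x₀} {p} fx₀≡p =
    p , λ y → mk⇔ (λ (x , fx≡y) → pc x x₀ y p fx≡y fx₀≡p) (λ { refl → x₀ , fx₀≡p })

  -- (ii, ⇒) the complement of the domain is the weak preimage of ∅
  constantMorphism⇒ : ∀ {f} → IsPartialConstant f → IsMorphism X f → EmptyOrPointOnOpen f
  constantMorphism⇒ {f} pc mor with emptyOrValue f
  ... | inj₁ empty            = inj₁ empty
  ... | inj₂ (x₀ , p , fx₀≡p) =
    inj₂ ((x₀ , value⇒∈Dom fx₀≡p) , (∁ (Dom f) , ∁Dom-subsystem , sym (∁-∁ (Dom f)))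
         , imageIsPoint pc fx₀≡p)
    where
    ∁Dom-subsystem : IsSubsystem X (∁ (Dom f))
    ∁Dom-subsystem = subst (IsSubsystem X) (wpre-avoiding f ⊥ (λ _ → ∉⊥)) (mor ⊥ ⊥-subsystem)

  -- (ii, ⇐) every weak preimage is either everything or ∁ (Dom f), the
  -- subsystem whose complement is the open domain
  constantMorphism⇐ : ∀ {f} → EmptyOrPointOnOpen f → IsMorphism X f
  constantMorphism⇐ {f} (inj₁ empty) F _ =
    subst (IsSubsystem X) (sym (wpre-covering f F noValue)) ⊤-subsystem
    where
    noValue : ∀ {x y} → f x ≡ just y → y ∈ F
    noValue {x} fx≡y = contradiction (trans (sym (empty x)) fx≡y) λ ()
  constantMorphism⇐ {f} (inj₂ (_ , (G , G-subsystem , Dom≡∁G) , (p , image))) F _ =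
    byPosition (p ∈? F)
    where
    valueIsP : ∀ {x y} → f x ≡ just y → y ≡ p
    valueIsP {x} {y} fx≡y = to (image y) (x , fx≡y)
    byPosition : Dec (p ∈ F) → IsSubsystem X (wpre X f F)
    byPosition (yes p∈F) =
      subst (IsSubsystem X) (sym (wpre-covering f F λ fx≡y → subst (_∈ F) (sym (valueIsP fx≡y)) p∈F))
            ⊤-subsystem
    byPosition (no p∉F) = subst (IsSubsystem X) (sym (begin
      wpre X f F ≡⟨ wpre-avoiding f F (λ fx≡y y∈F → p∉F (subst (_∈ F) (valueIsP fx≡y) y∈F)) ⟩
      ∁ (Dom f)  ≡⟨ cong ∁ Dom≡∁G ⟩
      ∁ (∁ G)    ≡⟨ ∁-∁ G ⟩
      G          ∎)) G-subsystem

corollary6p5 : ∀ {n : ℕ} (X : PBD n) →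
    (∀ (π : Permutation′ n) → IsMorphism X (asPartial π) ⇔ IsAutomorphism X π)
  × (∀ (f : Fin n → Maybe (Fin n)) → IsPartialConstant f →
      IsMorphism X f ⇔
        (IsEmptyFunction f ⊎
          ((∃[ x ] (x ∈ Dom f)) × IsOpen X (Dom f) × ImageIsPoint f)))
corollary6p5 X =
    (λ π → mk⇔ (morphism⇒automorphism X π) (automorphism⇒morphism X π))
  , (λ f pc → mk⇔ (constantMorphism⇒ X pc) (constantMorphism⇐ X))
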